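{- Let $p\in\mathbb{N}$, $p\ge 1$, and let $D$ be a digraph with circumference at most $p$ (i.e. $D$ has no directed cycle with more than $p$ vertices). Then the DAG-width of $D$ is at most $p$. Moreover this is best possible: for every $p\ge 1$ there is a digraph of circumference at most $p$ whose DAG-width equals $p$.
   Context: Directed cycles of length 2 (a pair of opposite arcs) count as cycles. For an acyclic digraph $H$, $\le_H$ denotes the reflexive, transitive closure of the arc relation of $H$; a root of $H$ is a $\le_H$-minimal vertex. For a digraph $D=(V,A)$, a set $W\subseteq V$ guards a set $V'\subseteq V$ if for every arc $uv\in A$ with $u\in V'$ and $v\notin V'$ we have $v\in W$. A DAG-decomposition of $D$ is a pair $(H,(X_h)_{h\in V(H)})$ where $H$ is an acyclic digraph and each $X_h\subseteq V(D)$, such that: (D1) $\bigcup_{h\in V(H)}X_h=V(D)$; (D2) for all $h,h',h''\in V(H)$ with $h\le_H h'\le_H h''$ we have $X_h\cap X_{h''}\subseteq X_{h'}$; (D3) for every arc $(h,h')$ of $H$, the set $X_h\cap X_{h'}$ guards $X_{\ge h'}\setminus X_h$, where $X_{\ge h'}=\bigcup_{h'\le_H h''}X_{h''}$, and for every root $h$ of $H$ the set $X_{\ge h}$ is guarded by $\emptyset$. The width of the decomposition is $\max_h |X_h|$, and the DAG-width of $D$ is the minimum width of a DAG-decomposition of $D$. -}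

module Defs where

open import Data.Nat using (ℕ; zero; suc; _≤_; _⊔_)
open import Data.Bool using (Bool; T)
open import Data.Fin using (Fin; zero; suc; inject₁; fromℕ)
open import Data.Fin.Subset using (Subset; _∈_; _∉_; ∣_∣)
open import Data.List using (foldr; map; allFin)
open import Data.Product using (Σ; ∃; _×_)
open import Data.Empty using (⊥)
open import Relation.Nullary using (¬_)
open import Relation.Binary.PropositionalEquality using (_≡_)
open import Relation.Binary.Construct.Closure.ReflexiveTransitive using (Star)
open import Function.Definitions using (Injective)

record Digraph : Set where
  field
    size : ℕ
    arc  : Fin size → Fin size → Bool

open Digraph public

Arc : (D : Digraph) → Fin (size D) → Fin (size D) → Set
Arc D u v = T (arc D u v)

-- A directed cycle with (suc m) distinct vertices c 0, …, c m:
-- arcs c i → c (i+1) for i < m, and c m → c 0.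
record Cycle (D : Digraph) (m : ℕ) : Set where
  field
    vtx      : Fin (suc m) → Fin (size D)
    distinct : Injective _≡_ _≡_ vtx
    step     : ∀ (i : Fin m) → Arc D (vtx (inject₁ i)) (vtx (suc i))
    close    : Arc D (vtx (fromℕ m)) (vtx zero)

CircumferenceAtMost : Digraph → ℕ → Set
CircumferenceAtMost D p = ∀ m → Cycle D m → suc m ≤ p

Acyclic : Digraph → Set
Acyclic H = ∀ m → ¬ Cycle H m

Leq : (H : Digraph) → Fin (size H) → Fin (size H) → Set
Leq H = Star (Arc H)

IsRoot : (H : Digraph) → Fin (size H) → Set
IsRoot H h = ∀ h' → Leq H h' h → h' ≡ h

Guards : (D : Digraph) → (Fin (size D) → Set) → (Fin (size D) → Set) → Set
Guards D W V' = ∀ u v → Arc D u v → V' u → ¬ V' v → W v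

record DAGDecomposition (D : Digraph) : Set₁ where
  field
    H       : Digraph
    acyclic : Acyclic H
    bag     : Fin (size H) → Subset (size D)
  Above : Fin (size H) → Fin (size D) → Set
  Above h v = Σ (Fin (size H)) λ h'' → Leq H h h'' × v ∈ bag h''
  field
    D1 : ∀ v → Σ (Fin (size H)) λ h → v ∈ bag h
    D2 : ∀ h h' h'' → Leq H h h' → Leq H h' h'' →
         ∀ v → v ∈ bag h → v ∈ bag h'' → v ∈ bag h'
    D3-arc  : ∀ h h' → Arc H h h' →
              Guards D (λ v → v ∈ bag h × v ∈ bag h')
                       (λ v → Above h' v × v ∉ bag h)
    D3-root : ∀ h → IsRoot H h → Guards D (λ _ → ⊥) (Above h)

  -- width = max_h |X_h|  (0 if H is empty)
  width : ℕ
  width = foldr _⊔_ 0 (map (λ h → ∣ bag h ∣) (allFin (size H)))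

open DAGDecomposition public

DAGWidthAtMost : Digraph → ℕ → Set₁
DAGWidthAtMost D k = Σ (DAGDecomposition D) λ dec → width dec ≤ k

DAGWidthEq : Digraph → ℕ → Set₁
DAGWidthEq D k = (Σ (DAGDecomposition D) λ dec → width dec ≡ k)
               × (∀ (dec : DAGDecomposition D) → k ≤ width dec)

-- Take as nodes the directed paths with at most p vertices, each bagged with its vertex set,
-- and an arc from a path to each path obtained by appending an arc at its end and, if that gives p + 1
-- vertices, dropping the first one.  Below a path P ending in v lies exactly the region made of the other
-- vertices of P and of everything reachable from v avoiding P.  Dropping the first vertex w never enlarges
-- this region, because walking back to w would close a cycle on more than p vertices; so regions shrink
-- strictly along arcs, which gives acyclicity, convexity of bags and the guarding conditions.
--
-- In the complete digraph on p vertices, X≥ r of a root r above any vertex is everything, and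
-- passing to the child below which a vertex missing from the bag lies keeps X≥ everything, by guarding.
-- By finiteness this descent stops at a bag containing all p vertices.

module Submission where

open import Defs
open import Data.Nat using (ℕ; _≤_)
open import Data.Product using (Σ; _×_)

open import Level using (0ℓ)
open import Data.Bool using (false; not)
open import Data.Empty using (⊥; ⊥-elim)
open import Data.Unit using (tt)
open import Data.Nat using (zero; suc; _<_; _+_; _*_; _⊔_; s≤s; z≤n; z<s; _≤?_)
open import Data.Nat.Properties
  using ( ≤-refl; ≤-reflexive; ≤-trans; ≤-antisym; ≤-pred; <-irrefl; <-≤-trans; ≰⇒>; n≮0; 1+n≢n
        ; suc-injective; m<m+n; m≤n⇒m≤1+n; m≤m⊔n; m≤n⊔m; ⊔-lub; ⊔-identityʳ; m⊓n≤m; module ≤-Reasoning )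
open import Data.Product using (∃; ∃₂; _,_; proj₁; proj₂)
open import Data.Sum as Sum using (_⊎_; inj₁; inj₂)
open import Data.Fin using (Fin; zero; suc; inject₁; fromℕ; _≟_; combine; remQuot)
open import Data.Fin.Properties using (injective⇒≤; remQuot-combine; all?; ¬∀⟶∃¬)
open import Data.Fin.Subset using (Subset; ∣_∣; ⁅_⁆; _∪_; inside; outside)
  renaming (_∈_ to _∈ₛ_; _∉_ to _∉ₛ_; ⊤ to ⊤ₛ; ⊥ to ⊥ₛ)
open import Data.Fin.Subset.Properties
  using ( ∈⊤; ∉⊥; ∣⊤∣≡n; ∣⊥∣≡0; p⊆q⇒∣p∣≤∣q∣; ∣p∣≤∣x∷p∣; ∪-identityˡ; x∈p∪q⁺; x∈p∪q⁻; x∈⁅x⁆; x∈⁅y⁆⇒x≡y )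
  renaming (_∈?_ to _∈ₛ?_)
open import Data.Vec using (_∷_)
open import Data.List using (List; []; _∷_; _++_; _ʳ++_; length; lookup; take; foldr)
open import Data.List.Properties
  using (take++drop≡id; take-all; length-take; ++-ʳ++; length-ʳ++; ≡-dec; foldr-preservesᵒ; foldr-preservesᵇ)
open import Data.List.Membership.Propositional using (_∈_; _∉_)
open import Data.List.Membership.Propositional.Properties using (∈-lookup; ∈-++⁺ˡ; ∈-++⁻; ∈-allFin)
import Data.List.Membership.DecPropositional as DecMembership
open import Data.List.Relation.Unary.All as All using (All; []; _∷_)
open import Data.List.Relation.Unary.All.Properties as All using (¬Any⇒All¬; All¬⇒¬Any)
open import Data.List.Relation.Unary.AllPairs using ([]; _∷_)
open import Data.List.Relation.Unary.Any using (here; there)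
import Data.List.Relation.Unary.Any as Any
import Data.List.Relation.Unary.Any.Properties as Any
open import Data.List.Relation.Unary.Linked as Linked using (Linked; []; [-]; _∷_; linked?)
open import Data.List.Relation.Unary.Unique.Propositional using (Unique)
open import Data.List.Relation.Unary.Unique.Propositional.Properties using (take⁺)
import Data.List.Relation.Unary.Unique.DecPropositional as DecUnique
open import Data.List.Relation.Binary.Disjoint.Propositional using (Disjoint)
open import Effect.Monad using (RawMonad)
open import Function using (flip; id; _∘_; case_of_)
open import Function.Definitions using (Injective)
open import Induction.WellFounded using (WellFounded; Acc; acc)
import Induction.WellFounded as WF
open import Relation.Binary using (Rel)
open import Relation.Binary.Construct.Closure.ReflexiveTransitive as Star using (Star; ε; _◅_; _◅◅_)
open import Relation.Binary.PropositionalEquality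
  using (_≡_; _≢_; refl; sym; trans; cong; subst; subst₂; module ≡-Reasoning)
open import Relation.Nullary using (¬_; Dec; yes; no; does; ¬?)
open import Relation.Nullary.Decidable
  using (_×-dec_; T?; ⌊_⌋; toWitness; fromWitness; decidable-stable; ¬¬-excluded-middle)
open import Relation.Nullary.Negation using (¬¬-Monad)

module _ {A : Set} where

  final : A → List A → A
  final x []      = x
  final _ (y ∷ t) = final y t

  final-ʳ++ : ∀ xs {x y : A} {ys} → final x (xs ʳ++ y ∷ ys) ≡ final y ys
  final-ʳ++ []       = refl
  final-ʳ++ (z ∷ xs) = final-ʳ++ xs

  lookup-last : ∀ (x : A) t → lookup (x ∷ t) (fromℕ (length t)) ≡ final x t
  lookup-last x []      = refl
  lookup-last x (y ∷ t) = lookup-last y t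

  ∈-take : ∀ k {x : A} {l} → x ∈ take k l → x ∈ l
  ∈-take k {l = l} x∈ = subst (_ ∈_) (take++drop≡id k l) (∈-++⁺ˡ x∈)

  take-++-last : ∀ k (l : List A) → length l ≡ suc k → ∃ λ w → l ≡ take k l ++ w ∷ []
  take-++-last zero    (w ∷ []) _   = w , refl
  take-++-last (suc k) (x ∷ l)  len = let w , l≡ = take-++-last k l (suc-injective len) in w , cong (x ∷_) l≡

  ∉-∷ : ∀ {x y : A} {S} → y ≢ x → y ∉ S → y ∉ x ∷ S
  ∉-∷ y≢x _   (here y≡x) = y≢x y≡x
  ∉-∷ _   y∉S (there y∈S) = y∉S y∈S

  fresh : ∀ {x : A} {l} → x ∉ l → Unique l → Unique (x ∷ l)
  fresh {l = l} x∉ u = ¬Any⇒All¬ l x∉ ∷ u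

  Unique-ʳ++ : ∀ {xs ys : List A} → Unique xs → Unique ys → Disjoint xs ys → Unique (xs ʳ++ ys)
  Unique-ʳ++ {[]}     _          uys _        = uys
  Unique-ʳ++ {x ∷ xs} (x≢ ∷ uxs) uys disjoint =
    Unique-ʳ++ uxs (fresh (λ x∈ys → disjoint (here refl , x∈ys)) uys) disjoint′
    where
    disjoint′ : Disjoint xs (x ∷ _)
    disjoint′ (z∈xs , here refl)  = All.lookup x≢ z∈xs refl
    disjoint′ (z∈xs , there z∈ys) = disjoint (there z∈xs , z∈ys)

  Linked-ʳ++ : ∀ {R : Rel A 0ℓ} {x l acc} → Linked (flip R) (x ∷ l) → Linked R (x ∷ acc) →
               Linked R ((x ∷ l) ʳ++ acc)
  Linked-ʳ++ {l = []}    _       c = c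
  Linked-ʳ++ {l = _ ∷ _} (r ∷ c′) c = Linked-ʳ++ c′ (r ∷ c)

  Linked-take : ∀ {R : Rel A 0ℓ} k {x l} → Linked R (x ∷ l) → Linked R (x ∷ take k l)
  Linked-take zero                _       = [-]
  Linked-take (suc k) {l = []}    c       = c
  Linked-take (suc k) {l = _ ∷ _} (r ∷ c) = r ∷ Linked-take k c

  lookup-injective : ∀ {l : List A} → Unique l → Injective _≡_ _≡_ (lookup l)
  lookup-injective {_ ∷ _} (_ ∷ _)  {zero}  {zero}  _  = refl
  lookup-injective {_ ∷ _} (x≢ ∷ _) {zero}  {suc j} eq = ⊥-elim (All.lookup x≢ (∈-lookup j) eq)
  lookup-injective {_ ∷ _} (x≢ ∷ _) {suc i} {zero}  eq = ⊥-elim (All.lookup x≢ (∈-lookup i) (sym eq))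
  lookup-injective {_ ∷ _} (_ ∷ u)  {suc i} {suc j} eq = cong suc (lookup-injective u eq)

module _ {n : ℕ} where

  Unique⇒length≤ : ∀ {l : List (Fin n)} → Unique l → length l ≤ n
  Unique⇒length≤ u = injective⇒≤ (lookup-injective u)

  vertexSet : List (Fin n) → Subset n
  vertexSet = foldr (λ x s → ⁅ x ⁆ ∪ s) ⊥ₛ

  ∈-vertexSet⁺ : ∀ {x l} → x ∈ l → x ∈ₛ vertexSet l
  ∈-vertexSet⁺ {l = y ∷ l} (here refl) = x∈p∪q⁺ (inj₁ (x∈⁅x⁆ y))
  ∈-vertexSet⁺ {l = y ∷ l} (there x∈)  = x∈p∪q⁺ (inj₂ (∈-vertexSet⁺ x∈))

  ∈-vertexSet⁻ : ∀ {x} l → x ∈ₛ vertexSet l → x ∈ l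
  ∈-vertexSet⁻ []      x∈ = ⊥-elim (∉⊥ x∈)
  ∈-vertexSet⁻ (y ∷ l) x∈ with x∈p∪q⁻ ⁅ y ⁆ (vertexSet l) x∈
  ... | inj₁ x∈y = here (x∈⁅y⁆⇒x≡y y x∈y)
  ... | inj₂ x∈l = there (∈-vertexSet⁻ l x∈l)

  ∣vertexSet∣≤length : ∀ l → ∣ vertexSet l ∣ ≤ length l
  ∣vertexSet∣≤length []      = ≤-reflexive (∣⊥∣≡0 n)
  ∣vertexSet∣≤length (x ∷ l) = ≤-trans (∣⁅x⁆∪p∣≤1+∣p∣ x (vertexSet l)) (s≤s (∣vertexSet∣≤length l))
    where
    ∣⁅x⁆∪p∣≤1+∣p∣ : ∀ {k} (x : Fin k) p → ∣ ⁅ x ⁆ ∪ p ∣ ≤ suc ∣ p ∣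
    ∣⁅x⁆∪p∣≤1+∣p∣ zero    (b ∷ p)       =
      s≤s (≤-trans (≤-reflexive (cong ∣_∣ (∪-identityˡ p))) (∣p∣≤∣x∷p∣ b p))
    ∣⁅x⁆∪p∣≤1+∣p∣ (suc x) (inside ∷ p)  = s≤s (∣⁅x⁆∪p∣≤1+∣p∣ x p)
    ∣⁅x⁆∪p∣≤1+∣p∣ (suc x) (outside ∷ p) = ∣⁅x⁆∪p∣≤1+∣p∣ x p


module ListCoding (n : ℕ) where

  -- ListCode k = 1 + n + ⋯ + nᵏ numbers the lists of length ≤ k: [] is 0 and x ∷ l is 1 + combine x (code of l).
  ListCode : ℕ → ℕ
  ListCode zero    = 1
  ListCode (suc k) = suc (n * ListCode k)

  encode : ∀ k (l : List (Fin n)) → length l ≤ k → Fin (ListCode k)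
  encode zero    []      _        = zero
  encode (suc k) []      _        = zero
  encode (suc k) (x ∷ l) (s≤s le) = suc (combine x (encode k l le))

  decode : ∀ k → Fin (ListCode k) → List (Fin n)
  decode zero    _       = []
  decode (suc k) zero    = []
  decode (suc k) (suc i) = let x , j = remQuot (ListCode k) i in x ∷ decode k j

  decode-encode : ∀ k l (le : length l ≤ k) → decode k (encode k l le) ≡ l
  decode-encode zero    []      _        = refl
  decode-encode (suc k) []      _        = refl
  decode-encode (suc k) (x ∷ l) (s≤s le) = begin
    decode (suc k) (encode (suc k) (x ∷ l) (s≤s le))
      ≡⟨ cong (λ (y , j) → y ∷ decode k j) (remQuot-combine x (encode k l le)) ⟩
    x ∷ decode k (encode k l le)
      ≡⟨ cong (x ∷_) (decode-encode k l le) ⟩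
    x ∷ l ∎
    where open ≡-Reasoning

ClosedWalk : ∀ {n} → Rel (Fin n) 0ℓ → Set
ClosedWalk R = ∃₂ λ x y → R x y × Star R y x

module _ {n : ℕ} {R : Rel (Fin n) 0ℓ} where

  open DecMembership (_≟_ {n}) using (_∈?_)

  SimplePath : Fin n → Fin n → Set
  SimplePath x y = Σ (List (Fin n)) λ t → Unique (x ∷ t) × Linked R (x ∷ t) × final x t ≡ y

  walk-to-member : ∀ {x z t} → x ∈ z ∷ t → Linked R (z ∷ t) → Star R z x
  walk-to-member (here refl)              _       = ε
  walk-to-member {t = _ ∷ _} (there x∈)  (r ∷ c) = r ◅ walk-to-member x∈ c

  path-from-member : ∀ {x z t} → x ∈ z ∷ t → Unique (z ∷ t) → Linked R (z ∷ t) → SimplePath x (final z t)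
  path-from-member {t = t} (here refl) u c = t , u , c , refl
  path-from-member {t = _ ∷ _} (there x∈) (_ ∷ u) (_ ∷ c) = path-from-member x∈ u c

  erase-loops : ∀ {x y} → Star R x y → SimplePath x y
  erase-loops ε = [] , [] ∷ [] , [-] , refl
  erase-loops {x} (_◅_ {j = z} r s) with erase-loops s
  ... | t , u , c , end with x ∈? z ∷ t
  ...   | yes x∈ = let t′ , u′ , c′ , end′ = path-from-member x∈ u c in t′ , u′ , c′ , trans end′ end
  ...   | no x∉  = z ∷ t , fresh x∉ u , r ∷ c , end

  unique⊎closedWalk : ∀ l → Linked R l → Unique l ⊎ ClosedWalk R
  unique⊎closedWalk []      _ = inj₁ []
  unique⊎closedWalk (_ ∷ []) _ = inj₁ ([] ∷ [])
  unique⊎closedWalk (x ∷ z ∷ t) (r ∷ c) with unique⊎closedWalk (z ∷ t) c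
  ... | inj₂ cw = inj₂ cw
  ... | inj₁ u with x ∈? z ∷ t
  ...   | yes x∈ = inj₂ (x , z , r , walk-to-member x∈ c)
  ...   | no x∉  = inj₁ (fresh x∉ u)

  ¬closedWalk⇒wellFounded : ¬ ClosedWalk R → WellFounded (flip R)
  ¬closedWalk⇒wellFounded ¬cw x = accessible n x short
    where
    short : ∀ {x} l → Linked R (x ∷ l) → length l < n
    short l c with unique⊎closedWalk _ c
    ... | inj₁ u  = Unique⇒length≤ u
    ... | inj₂ cw = ⊥-elim (¬cw cw)
    accessible : ∀ k x → (∀ l → Linked R (x ∷ l) → length l < k) → Acc (flip R) x
    accessible zero    _ bound = ⊥-elim (n≮0 (bound [] [-]))
    accessible (suc k) _ bound = acc λ r → accessible k _ λ l c → ≤-pred (bound (_ ∷ l) (r ∷ c))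

Avoiding : ∀ {n} → Rel (Fin n) 0ℓ → List (Fin n) → Rel (Fin n) 0ℓ
Avoiding R S x y = R x y × y ∉ S

module _ {n : ℕ} {R : Rel (Fin n) 0ℓ} where

  avoiding-end : ∀ {S x y} → x ∉ S → Star (Avoiding R S) x y → y ∉ S
  avoiding-end x∉ ε              = x∉
  avoiding-end _  ((_ , y∉) ◅ s) = avoiding-end y∉ s

  avoiding-anti : ∀ {S S′} → (∀ {y} → y ∈ S → y ∈ S′) → ∀ {x y} → Avoiding R S′ x y → Avoiding R S x y
  avoiding-anti S⊆S′ (r , y∉) = r , y∉ ∘ S⊆S′

  linked-avoiding-∷ : ∀ {x S y t} → All (x ≢_) t → Linked (Avoiding R S) (y ∷ t) →
                      Linked (Avoiding R (x ∷ S)) (y ∷ t)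
  linked-avoiding-∷ []            [-]              = [-]
  linked-avoiding-∷ (x≢z ∷ x≢zs) ((r , z∉) ∷ c) = (r , ∉-∷ (x≢z ∘ sym) z∉) ∷ linked-avoiding-∷ x≢zs c

  linked-avoiding⇒All∉ : ∀ {S x t} → Linked (Avoiding R S) (x ∷ t) → All (_∉ S) t
  linked-avoiding⇒All∉ [-]              = []
  linked-avoiding⇒All∉ ((_ , y∉) ∷ c) = y∉ ∷ linked-avoiding⇒All∉ c

  first-hit : ∀ {T w x y} → Star (Avoiding R T) x y →
              Star (Avoiding R (T ++ w ∷ [])) x y ⊎ ∃ λ u → Star (Avoiding R (T ++ w ∷ [])) x u × R u w
  first-hit ε = inj₁ ε
  first-hit {T} {w} (_◅_ {j = z} (r , z∉T) s) with z ≟ w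
  ... | yes refl = inj₂ (_ , ε , r)
  ... | no z≢w   = Sum.map (step ◅_) (λ (u , s′ , r′) → u , step ◅ s′ , r′) (first-hit s)
    where
    z∉ : z ∉ T ++ w ∷ []
    z∉ z∈ with ∈-++⁻ T z∈
    ... | inj₁ z∈T        = z∉T z∈T
    ... | inj₂ (here z≡w) = z≢w z≡w
    step = r , z∉

module _ (G : Digraph) where

  cycle-from-path : ∀ {x t} → Unique (x ∷ t) → Linked (Arc G) (x ∷ t) → Arc G (final x t) x →
                    Cycle G (length t)
  cycle-from-path {x} {t} u c closing = record
    { vtx      = lookup (x ∷ t)
    ; distinct = lookup-injective u
    ; step     = steps c
    ; close    = subst (λ z → Arc G z x) (sym (lookup-last x t)) closing
    }
    where
    steps : ∀ {x t} → Linked (Arc G) (x ∷ t) →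
            (i : Fin (length t)) → Arc G (lookup (x ∷ t) (inject₁ i)) (lookup t i)
    steps {t = _ ∷ _} (r ∷ _) zero    = r
    steps {t = _ ∷ _} (_ ∷ c) (suc i) = steps c i

  cycle⇒closedWalk : ∀ {m} → Cycle G m → ClosedWalk (Arc G)
  cycle⇒closedWalk {m} c = _ , _ , Cycle.close c , along m (Cycle.vtx c) (Cycle.step c)
    where
    along : ∀ m (f : Fin (suc m) → Fin (size G)) → (∀ i → Arc G (f (inject₁ i)) (f (suc i))) →
            Star (Arc G) (f zero) (f (fromℕ m))
    along zero    _ _    = ε
    along (suc m) f step = step zero ◅ along m (f ∘ suc) (step ∘ suc)

  closedWalk⇒cycle : ClosedWalk (Arc G) → ∃ (Cycle G)
  closedWalk⇒cycle (x , y , r , s) with erase-loops s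
  ... | t , u , c , end = length t , cycle-from-path u c (subst (λ z → Arc G z y) (sym end) r)

  acyclic⇒¬closedWalk : Acyclic G → ¬ ClosedWalk (Arc G)
  acyclic⇒¬closedWalk acyc cw = let m , cyc = closedWalk⇒cycle cw in acyc m cyc

  acyclic⇒¬closedWalkᵒ : Acyclic G → ¬ ClosedWalk (flip (Arc G))
  acyclic⇒¬closedWalkᵒ acyc (x , y , r , s) = acyclic⇒¬closedWalk acyc (y , x , r , Star.reverse id s)

module _ {D : Digraph} (dec : DAGDecomposition D) where

  open RawMonad (¬¬-Monad {0ℓ})

  bag≤width : ∀ h → ∣ bag dec h ∣ ≤ width dec
  bag≤width h = foldr-preservesᵒ ⊔-upper 0 _ (inj₂ (Any.map⁺ (Any.map (λ { refl → ≤-refl }) (∈-allFin h))))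
    where
    ⊔-upper : ∀ x y → ∣ bag dec h ∣ ≤ x ⊎ ∣ bag dec h ∣ ≤ y → ∣ bag dec h ∣ ≤ x ⊔ y
    ⊔-upper x y (inj₁ le) = ≤-trans le (m≤m⊔n x y)
    ⊔-upper x y (inj₂ le) = ≤-trans le (m≤n⊔m x y)

  width≤ : ∀ {k} → (∀ h → ∣ bag dec h ∣ ≤ k) → width dec ≤ k
  width≤ {k} bound = foldr-preservesᵇ {P = _≤ k} ⊔-lub z≤n (All.map⁺ (All.tabulate⁺ bound))

  parent-of-nonroot : ∀ {h} → ¬ IsRoot (H dec) h → ¬ ¬ ∃ λ g → Arc (H dec) g h
  parent-of-nonroot {h} ¬root ¬parent =
    ¬root λ g g≤h → decidable-stable (g ≟ h) λ g≢h → ¬parent (last-arc g≢h (Star.reverse id g≤h))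
    where
    last-arc : ∀ {g} → g ≢ h → Star (flip (Arc (H dec))) h g → ∃ λ z → Arc (H dec) z h
    last-arc g≢h ε       = ⊥-elim (g≢h refl)
    last-arc _   (r ◅ _) = _ , r

  root-below : ∀ h → ¬ ¬ ∃ λ r → IsRoot (H dec) r × Leq (H dec) r h
  root-below = WF.All.wfRec (¬closedWalk⇒wellFounded (acyclic⇒¬closedWalkᵒ (H dec) (acyclic dec))) 0ℓ _ step
    where
    step : ∀ h → (∀ {g} → Arc (H dec) g h → ¬ ¬ ∃ λ r → IsRoot (H dec) r × Leq (H dec) r g) →
           ¬ ¬ ∃ λ r → IsRoot (H dec) r × Leq (H dec) r h
    step h below = ¬¬-excluded-middle >>= λ where
      (yes root) → pure (h , root , ε)
      (no ¬root) → parent-of-nonroot ¬root >>= λ (g , r) →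
                   below r >>= λ (s , root , s≤g) → pure (s , root , s≤g ◅◅ r ◅ ε)

  above-child : ∀ {h x} → Above dec h x → x ∉ₛ bag dec h → ∃ λ h′ → Arc (H dec) h h′ × Above dec h′ x
  above-child (_ , ε     , x∈) x∉ = ⊥-elim (x∉ x∈)
  above-child (_ , r ◅ s , x∈) _  = _ , r , _ , s , x∈

  guarded-child : ∀ {h h′ x y} → Arc (H dec) h h′ → Above dec h′ x → x ∉ₛ bag dec h → Arc D x y →
                  ¬ ¬ Above dec h′ y
  guarded-child {h} {h′} {x} {y} r Ax x∉ a ¬Ay =
    ¬Ay (h′ , ε , proj₂ (D3-arc dec h h′ r x y a (Ax , x∉) (¬Ay ∘ proj₁)))

  guarded-root : ∀ {h x y} → IsRoot (H dec) h → Above dec h x → Arc D x y → ¬ ¬ Above dec h y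
  guarded-root {h} {x} {y} root Ax a = D3-root dec h root x y a Ax

circumference≤size : ∀ D → CircumferenceAtMost D (size D)
circumference≤size D m c = injective⇒≤ (Cycle.distinct c)

trivial-decomposition : (D : Digraph) → DAGDecomposition D
trivial-decomposition D = record
  { H       = record { size = 1 ; arc = λ _ _ → false }
  ; acyclic = λ _ c → Cycle.close c
  ; bag     = λ _ → ⊤ₛ
  ; D1      = λ _ → zero , ∈⊤
  ; D2      = λ _ _ _ _ _ _ _ _ → ∈⊤
  ; D3-arc  = λ _ _ ()
  ; D3-root = λ h _ _ _ _ _ ∉above → ∉above (h , ε , ∈⊤)
  }

trivial-decomposition-width : ∀ D → width (trivial-decomposition D) ≡ size D
trivial-decomposition-width D = trans (⊔-identityʳ ∣ ⊤ₛ {size D} ∣) (∣⊤∣≡n (size D))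

complete : ℕ → Digraph
complete p = record { size = p ; arc = λ u v → not (does (u ≟ v)) }

complete-arc : ∀ {p} {u v : Fin p} → u ≢ v → Arc (complete p) u v
complete-arc {u = u} {v} u≢v with u ≟ v
... | yes u≡v = u≢v u≡v
... | no _    = tt

module _ {p : ℕ} (dec : DAGDecomposition (complete p)) where

  open RawMonad (¬¬-Monad {0ℓ})

  -- X≥ is not decidable, so the descent runs in the double-negation monad; its conclusion p ≤ width is decidable.
  Spans : Fin (size (H dec)) → Set
  Spans h = ∀ y → ¬ ¬ Above dec h y

  spans-if-guarded : ∀ {h x} → Above dec h x → (∀ {y} → Arc (complete p) x y → ¬ ¬ Above dec h y) → Spans h
  spans-if-guarded {x = x} Ax guarded y with x ≟ y
  ... | yes refl = pure Ax
  ... | no x≢y   = guarded (complete-arc x≢y)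

  full-bag-below : ∀ h → Spans h → ¬ ¬ ∃ λ h → ∀ y → y ∈ₛ bag dec h
  full-bag-below = WF.All.wfRec (¬closedWalk⇒wellFounded (acyclic⇒¬closedWalk (H dec) (acyclic dec))) 0ℓ _ step
    where
    step : ∀ h → (∀ {h′} → Arc (H dec) h h′ → Spans h′ → ¬ ¬ ∃ λ h → ∀ y → y ∈ₛ bag dec h) →
           Spans h → ¬ ¬ ∃ λ h → ∀ y → y ∈ₛ bag dec h
    step h below spans with all? (_∈ₛ? bag dec h)
    ... | yes full = pure (h , full)
    ... | no ¬full = let x , x∉ = ¬∀⟶∃¬ _ _ (_∈ₛ? bag dec h) ¬full in spans x >>= λ Ax →
                     let h′ , r , Ax′ = above-child dec Ax x∉ in
                     below r (spans-if-guarded Ax′ (guarded-child dec r Ax′ x∉))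

  full-bag⇒width≥ : ∀ {h} → (∀ y → y ∈ₛ bag dec h) → p ≤ width dec
  full-bag⇒width≥ {h} full = begin
    p                ≡⟨ ∣⊤∣≡n p ⟨
    ∣ ⊤ₛ {p} ∣       ≤⟨ p⊆q⇒∣p∣≤∣q∣ {p = ⊤ₛ} (λ {y} _ → full y) ⟩
    ∣ bag dec h ∣    ≤⟨ bag≤width dec h ⟩
    width dec        ∎
    where open ≤-Reasoning

  width≥-from-vertex : Fin p → p ≤ width dec
  width≥-from-vertex x = decidable-stable (p ≤? width dec) do
    let h₀ , x∈ = D1 dec x
    r , root , r≤h₀ ← root-below dec h₀
    let Ax = h₀ , r≤h₀ , x∈
    _ , full ← full-bag-below r (spans-if-guarded Ax (guarded-root dec root Ax))
    pure (full-bag⇒width≥ full)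

complete-width≥ : ∀ p (dec : DAGDecomposition (complete p)) → p ≤ width dec
complete-width≥ zero    _   = z≤n
complete-width≥ (suc p) dec = width≥-from-vertex dec zero

module UpperBound (q : ℕ) (D : Digraph) (circumference : CircumferenceAtMost D (suc q)) where

  private
    p : ℕ
    p = suc q

    V : Set
    V = Fin (size D)

  open DecMembership (_≟_ {size D}) using (_∈?_)
  open DecUnique (_≟_ {size D}) using (unique?)
  open ListCoding (size D)

  -- A directed path of D with at most p vertices, listed from its last vertex backwards.
  IsNode : List V → Set
  IsNode []       = ⊥
  IsNode (v ∷ ws) = Unique (v ∷ ws) × Linked (flip (Arc D)) (v ∷ ws) × length (v ∷ ws) ≤ p

  _↝_ : List V → List V → Set
  []       ↝ _          = ⊥
  (_ ∷ _)  ↝ []         = ⊥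
  (v ∷ ws) ↝ (v′ ∷ ws′) = IsNode (v ∷ ws) × Arc D v v′ × v′ ∉ v ∷ ws × ws′ ≡ take q (v ∷ ws)

  Reach : List V → V → Set
  Reach []       _ = ⊥
  Reach (v ∷ ws) r = Star (Avoiding (Arc D) ws) v r

  Territory : List V → V → Set
  Territory []       _ = ⊥
  Territory (v ∷ ws) r = r ∈ ws ⊎ Reach (v ∷ ws) r

  IsNode⇒length≤ : ∀ l → IsNode l → length l ≤ p
  IsNode⇒length≤ (_ ∷ _) (_ , _ , len) = len

  single-node : ∀ v → IsNode (v ∷ [])
  single-node v = [] ∷ [] , [-] , s≤s z≤n

  extend-node : ∀ {v ws v′} → IsNode (v ∷ ws) → Arc D v v′ → v′ ∉ v ∷ ws → IsNode (v′ ∷ take q (v ∷ ws))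
  extend-node {v} {ws} (u , c , _) a v′∉ =
    fresh (v′∉ ∘ ∈-take q) (take⁺ q u) , Linked-take q (a ∷ c) ,
    s≤s (≤-trans (≤-reflexive (length-take q (v ∷ ws))) (m⊓n≤m q _))

  ↝-from-tail : ∀ {v w ws} → IsNode (v ∷ w ∷ ws) → (w ∷ ws) ↝ (v ∷ w ∷ ws)
  ↝-from-tail (v≢ ∷ u , a ∷ c , s≤s len) =
    (u , c , m≤n⇒m≤1+n len) , a , All¬⇒¬Any v≢ , sym (take-all q _ len)

  -- Leaving a full path at its end and returning to its first vertex w closes a cycle on more than p vertices.
  no-long-detour : ∀ {v ws T w v′ t} → IsNode (v ∷ ws) → length (v ∷ ws) ≡ p → v ∷ ws ≡ T ++ w ∷ [] →
                   Arc D v v′ → v′ ∉ v ∷ ws → Unique (v′ ∷ t) → Linked (Avoiding (Arc D) (v ∷ ws)) (v′ ∷ t) →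
                   Arc D (final v′ t) w → ⊥
  no-long-detour {v} {ws} {T} {w} {v′} {t} (uL , lL , _) len L≡ a v′∉ uM lM closing =
    <-irrefl refl (<-≤-trans long (circumference _ cycle))
    where
    L M : List V
    L = v ∷ ws
    M = v′ ∷ t

    C≡ : L ʳ++ M ≡ w ∷ T ʳ++ M
    C≡ = trans (cong (_ʳ++ M) L≡) (++-ʳ++ T)

    disjoint : Disjoint L M
    disjoint (x∈L , here refl) = v′∉ x∈L
    disjoint (x∈L , there x∈t) = All.lookup (linked-avoiding⇒All∉ lM) x∈t x∈L

    cycle : Cycle D (length (T ʳ++ M))
    cycle = cycle-from-path D (subst Unique C≡ (Unique-ʳ++ uL uM disjoint))
                              (subst (Linked (Arc D)) C≡ (Linked-ʳ++ lL (a ∷ Linked.map proj₁ lM)))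
                              (subst (λ z → Arc D z w) (sym (final-ʳ++ T)) closing)

    long : p < suc (length (T ʳ++ M))
    long = begin-strict
      p                       <⟨ m<m+n p z<s ⟩
      p + length M            ≡⟨ cong (_+ length M) len ⟨
      length L + length M     ≡⟨ length-ʳ++ L ⟨
      length (L ʳ++ M)        ≡⟨ cong length C≡ ⟩
      suc (length (T ʳ++ M))  ∎
      where open ≤-Reasoning

  avoiding-take⇒avoiding-full : ∀ {v ws v′ r} → IsNode (v ∷ ws) → length (v ∷ ws) ≡ p → Arc D v v′ → v′ ∉ v ∷ ws →
    Star (Avoiding (Arc D) (take q (v ∷ ws))) v′ r → Star (Avoiding (Arc D) (v ∷ ws)) v′ r
  avoiding-take⇒avoiding-full {v} {ws} {v′} {r} node len a v′∉ s with take-++-last q (v ∷ ws) len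
  ... | w , L≡ with first-hit {w = w} s
  ...   | inj₁ s′ = subst (λ S → Star (Avoiding (Arc D) S) v′ r) (sym L≡) s′
  ...   | inj₂ (u , s′ , r′) with erase-loops (subst (λ S → Star (Avoiding (Arc D) S) v′ u) (sym L≡) s′)
  ...     | t , uM , lM , end =
    ⊥-elim (no-long-detour node len L≡ a v′∉ uM lM (subst (λ z → Arc D z w) (sym end) r′))

  avoiding-take⇒avoiding : ∀ {v ws v′ r} → IsNode (v ∷ ws) → Arc D v v′ → v′ ∉ v ∷ ws →
    Star (Avoiding (Arc D) (take q (v ∷ ws))) v′ r → Star (Avoiding (Arc D) (v ∷ ws)) v′ r
  avoiding-take⇒avoiding {v} {ws} {v′} {r} node a v′∉ s with length (v ∷ ws) ≤? q
  ... | yes short = subst (λ S → Star (Avoiding (Arc D) S) v′ r) (take-all q (v ∷ ws) short) s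
  ... | no ¬short = avoiding-take⇒avoiding-full node (≤-antisym (IsNode⇒length≤ _ node) (≰⇒> ¬short)) a v′∉ s

  reach-shrinks : ∀ {l l′ r} → l ↝ l′ → Reach l′ r → Reach l r × r ∉ l
  reach-shrinks {_ ∷ ws} {_ ∷ _} (node , a , v′∉ , refl) s =
    (a , v′∉ ∘ there) ◅ Star.map (avoiding-anti {R = Arc D} {S = ws} there) s′ , avoiding-end v′∉ s′
    where s′ = avoiding-take⇒avoiding node a v′∉ s

  territory-shrinks : ∀ {l l′ r} → l ↝ l′ → Territory l′ r → Territory l r
  territory-shrinks {_ ∷ _} {_ ∷ _} (_ , _ , _ , refl) (inj₁ r∈) with ∈-take q r∈
  ... | here refl  = inj₂ ε
  ... | there r∈ws = inj₁ r∈ws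
  territory-shrinks {_ ∷ _} {_ ∷ _} ext (inj₂ s) = inj₂ (proj₁ (reach-shrinks ext s))

  ∈⇒Territory : ∀ l {r} → r ∈ l → Territory l r
  ∈⇒Territory (_ ∷ _) (here refl) = inj₂ ε
  ∈⇒Territory (_ ∷ _) (there r∈)  = inj₁ r∈

  Territory-∈ : ∀ {l l′ r} → l ↝ l′ → r ∈ l → Territory l′ r → r ∈ l′
  Territory-∈ {_ ∷ _} {_ ∷ _} _   _  (inj₁ r∈) = there r∈
  Territory-∈ {_ ∷ _} {_ ∷ _} ext r∈ (inj₂ s)  = ⊥-elim (proj₂ (reach-shrinks ext s) r∈)

  territory-guarded : ∀ {l l′ u x} → l ↝ l′ → Arc D u x → Territory l′ u → u ∉ l →
                      (x ∈ l × x ∈ l′) ⊎ (Territory l′ x × x ∉ l)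
  territory-guarded {_ ∷ _} {_ ∷ _} (_ , _ , _ , refl) _ (inj₁ u∈) u∉ = ⊥-elim (u∉ (∈-take q u∈))
  territory-guarded {v ∷ ws} {_ ∷ _} {x = x} ext@(_ , _ , _ , refl) a (inj₂ s) _ with x ∈? take q (v ∷ ws)
  ... | yes x∈ = inj₁ (∈-take q x∈ , there x∈)
  ... | no x∉  = let s′ = s ◅◅ (a , x∉) ◅ ε in inj₂ (inj₂ s′ , proj₂ (reach-shrinks ext s′))

  head-reach : ∀ {l l′} → l ↝ l′ → ∃ λ v → v ∈ l × Reach l v
  head-reach {_ ∷ _} {_ ∷ _} _ = _ , here refl , ε

  isNode? : ∀ l → Dec (IsNode l)
  isNode? []       = no id
  isNode? (v ∷ ws) = unique? _ ×-dec linked? (λ x y → T? (arc D y x)) _ ×-dec length (v ∷ ws) ≤? p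

  _↝?_ : ∀ l l′ → Dec (l ↝ l′)
  []       ↝? _          = no id
  (_ ∷ _)  ↝? []         = no id
  (v ∷ ws) ↝? (v′ ∷ ws′) = isNode? (v ∷ ws) ×-dec T? (arc D v v′) ×-dec ¬? (v′ ∈? v ∷ ws)
                           ×-dec ≡-dec _≟_ ws′ (take q (v ∷ ws))

  Node : Set
  Node = Fin (ListCode p)

  -- Codes of lists that are not nodes become junk nodes with empty path, hence empty bag and no arcs.
  pathOf : ∀ l → Dec (IsNode l) → List V
  pathOf l (yes _) = l
  pathOf _ (no _)  = []

  path : Node → List V
  path h = pathOf (decode p h) (isNode? (decode p h))

  path-node : ∀ h → path h ≡ [] ⊎ IsNode (path h)
  path-node h with isNode? (decode p h)
  ... | yes node = inj₂ node
  ... | no _     = inj₁ refl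

  path-IsNode : ∀ h {v ws} → path h ≡ v ∷ ws → IsNode (v ∷ ws)
  path-IsNode h h≡ with path-node h
  ... | inj₁ h≡[] = case trans (sym h≡[]) h≡ of λ ()
  ... | inj₂ node = subst IsNode h≡ node

  node-path : ∀ l → IsNode l → ∃ λ h → path h ≡ l
  node-path l@(_ ∷ _) node = encode p l len , (begin
      pathOf (decode p (encode p l len)) (isNode? (decode p (encode p l len)))
        ≡⟨ cong (λ l′ → pathOf l′ (isNode? l′)) (decode-encode p l len) ⟩
      pathOf l (isNode? l)
        ≡⟨ pathOf-node (isNode? l) ⟩
      l ∎)
    where
    open ≡-Reasoning
    len = IsNode⇒length≤ l node
    pathOf-node : (d : Dec (IsNode l)) → pathOf l d ≡ l
    pathOf-node (yes _)    = refl
    pathOf-node (no ¬node) = ⊥-elim (¬node node)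

  PathDAG : Digraph
  PathDAG = record { size = ListCode p ; arc = λ h h′ → ⌊ path h ↝? path h′ ⌋ }

  arc⇒↝ : ∀ {h h′} → Arc PathDAG h h′ → path h ↝ path h′
  arc⇒↝ {h} {h′} = toWitness {a? = path h ↝? path h′}

  ↝⇒arc : ∀ {h h′} → path h ↝ path h′ → Arc PathDAG h h′
  ↝⇒arc {h} {h′} = fromWitness {a? = path h ↝? path h′}

  bagOf : Node → Subset (size D)
  bagOf h = vertexSet (path h)

  X≥ : Node → V → Set
  X≥ h r = Σ Node λ h″ → Leq PathDAG h h″ × r ∈ₛ bagOf h″

  X≥⇒Territory : ∀ {h h″ r} → Leq PathDAG h h″ → r ∈ₛ bagOf h″ → Territory (path h) r
  X≥⇒Territory {h} ε       r∈ = ∈⇒Territory (path h) (∈-vertexSet⁻ (path h) r∈)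
  X≥⇒Territory {h} (_◅_ {j = h′} a s) r∈ = territory-shrinks (arc⇒↝ {h} {h′} a) (X≥⇒Territory s r∈)

  simple-path⇒X≥ : ∀ h {x ws t} → path h ≡ x ∷ ws → Unique (x ∷ t) → Linked (Avoiding (Arc D) ws) (x ∷ t) →
                   X≥ h (final x t)
  simple-path⇒X≥ h {x} {t = []} h≡ _ _ = h , ε , ∈-vertexSet⁺ (subst (x ∈_) (sym h≡) (here refl))
  simple-path⇒X≥ h {x} {ws} {y ∷ t} h≡ ((x≢y ∷ x≢t) ∷ u) ((a , y∉ws) ∷ c) =
    let y∉ = ∉-∷ (x≢y ∘ sym) y∉ws
        node = path-IsNode h h≡
        h′ , h′≡ = node-path _ (extend-node node a y∉)
        h→h′ = ↝⇒arc {h} {h′} (subst₂ _↝_ (sym h≡) (sym h′≡) (node , a , y∉ , refl))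
        c′ = Linked.map (avoiding-anti {R = Arc D} {S′ = x ∷ ws} (∈-take q)) (linked-avoiding-∷ x≢t c)
        h″ , h′≤h″ , r∈ = simple-path⇒X≥ h′ h′≡ u c′
    in h″ , h→h′ ◅ h′≤h″ , r∈

  Territory⇒X≥ : ∀ h {r} → Territory (path h) r → X≥ h r
  Territory⇒X≥ h {r} territory with path h in h≡
  ... | _ ∷ _ with territory
  ...   | inj₁ r∈ = h , ε , ∈-vertexSet⁺ (subst (r ∈_) (sym h≡) (there r∈))
  ...   | inj₂ s  = let t , u , c , end = erase-loops s in subst (X≥ h) end (simple-path⇒X≥ h h≡ u c)

  reach-along : ∀ {h h′ r} → Leq PathDAG h h′ → Reach (path h′) r → Reach (path h) r
  reach-along             ε                  s = s
  reach-along {h} (_◅_ {j = h′} a t) s = proj₁ (reach-shrinks (arc⇒↝ {h} {h′} a) (reach-along t s))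

  acyclic-PathDAG : Acyclic PathDAG
  acyclic-PathDAG _ c with cycle⇒closedWalk PathDAG c
  ... | h , h′ , a , h′≤h = let h↝h′ = arc⇒↝ {h} {h′} a
                                v , v∈ , reach = head-reach h↝h′
                            in proj₂ (reach-shrinks h↝h′ (reach-along h′≤h reach)) v∈

  bags-convex : ∀ h h′ h″ → Leq PathDAG h h′ → Leq PathDAG h′ h″ →
                ∀ x → x ∈ₛ bagOf h → x ∈ₛ bagOf h″ → x ∈ₛ bagOf h′
  bags-convex h _  _  ε       _     _ x∈ _   = x∈
  bags-convex h h′ h″ (_◅_ {j = h₁} a t) h′≤h″ x x∈ x∈″ =
    bags-convex _ h′ h″ t h′≤h″ x
      (∈-vertexSet⁺ (Territory-∈ (arc⇒↝ {h} {h₁} a) (∈-vertexSet⁻ (path h) x∈) (X≥⇒Territory (t ◅◅ h′≤h″) x∈″)))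
      x∈″

  guards-arc : ∀ h h′ → Arc PathDAG h h′ →
               Guards D (λ v → v ∈ₛ bagOf h × v ∈ₛ bagOf h′) (λ v → X≥ h′ v × v ∉ₛ bagOf h)
  guards-arc h h′ a u x ux ((_ , t , u∈) , u∉) ¬X
    with territory-guarded (arc⇒↝ {h} {h′} a) ux (X≥⇒Territory t u∈) (u∉ ∘ ∈-vertexSet⁺)
  ... | inj₁ (x∈ , x∈′)       = ∈-vertexSet⁺ x∈ , ∈-vertexSet⁺ x∈′
  ... | inj₂ (territory , x∉) = ⊥-elim (¬X (Territory⇒X≥ h′ territory , x∉ ∘ ∈-vertexSet⁻ (path h)))

  -- A root holds a single vertex: a longer path is the extension of its own tail.
  guards-root : ∀ h → IsRoot PathDAG h → Guards D (λ _ → ⊥) (X≥ h)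
  guards-root h root u x ux (_ , t , u∈) ¬X with path h in h≡ | X≥⇒Territory t u∈
  ... | _ ∷ [] | inj₂ s =
    ¬X (Territory⇒X≥ h (subst (λ l → Territory l x) (sym h≡) (inj₂ (s ◅◅ (ux , λ ()) ◅ ε))))
  ... | v ∷ w ∷ ws | _ =
    let node = path-IsNode h h≡
        h₀ , h₀≡ = node-path _ (proj₁ (↝-from-tail node))
        h₀≡h = root h₀ (↝⇒arc {h₀} {h} (subst₂ _↝_ (sym h₀≡) (sym h≡) (↝-from-tail node)) ◅ ε)
    in ⊥-elim (1+n≢n (cong length (trans (sym h≡) (trans (cong path (sym h₀≡h)) h₀≡))))

  decomposition : DAGDecomposition D
  decomposition = record
    { H       = PathDAG
    ; acyclic = acyclic-PathDAG
    ; bag     = bagOf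
    ; D1      = λ x → let h , h≡ = node-path _ (single-node x)
                      in h , ∈-vertexSet⁺ (subst (x ∈_) (sym h≡) (here refl))
    ; D2      = bags-convex
    ; D3-arc  = guards-arc
    ; D3-root = guards-root
    }

  bag-size : ∀ h → ∣ bagOf h ∣ ≤ p
  bag-size h with path-node h
  ... | inj₁ h≡[] = subst (λ l → ∣ vertexSet l ∣ ≤ p) (sym h≡[]) (≤-trans (≤-reflexive (∣⊥∣≡0 (size D))) z≤n)
  ... | inj₂ node = ≤-trans (∣vertexSet∣≤length (path h)) (IsNode⇒length≤ (path h) node)

  width-decomposition : width decomposition ≤ p
  width-decomposition = width≤ decomposition bag-size

circumference⇒DAGWidth≤ : ∀ p → 1 ≤ p → ∀ D → CircumferenceAtMost D p → DAGWidthAtMost D p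
circumference⇒DAGWidth≤ (suc q) _ D circumference = decomposition , width-decomposition
  where open UpperBound q D circumference

complete-DAGWidth : ∀ p → DAGWidthEq (complete p) p
complete-DAGWidth p = (trivial-decomposition (complete p) , trivial-decomposition-width (complete p)) , complete-width≥ p

mainTheorem1 : (∀ (p : ℕ) → 1 ≤ p → ∀ (D : Digraph) → CircumferenceAtMost D p → DAGWidthAtMost D p)
    × (∀ (p : ℕ) → 1 ≤ p → Σ Digraph λ D → CircumferenceAtMost D p × DAGWidthEq D p)
mainTheorem1 = circumference⇒DAGWidth≤ , λ p _ → complete p , circumference≤size (complete p) , complete-DAGWidth p
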